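{- Let $r \geq 2$ be an integer. Every graph $G$ with $m \geq 1$ edges contains a $K_{r,r}$-free subgraph with at least $\frac{1}{4}m^{\frac{r}{r+1}}$ edges.
   Context: $K_{r,r}$ denotes the complete bipartite graph with both parts of size $r$. A graph is $K_{r,r}$-free if it contains no subgraph isomorphic to $K_{r,r}$. Graphs are finite and simple; a subgraph of $G$ is obtained by taking a subset of the edges of $G$. -}

module Defs where

open import Data.Nat using (ℕ; _<_)
open import Data.Fin using (Fin; toℕ)
open import Data.Product using (Σ; _×_; _,_; proj₁; proj₂)
open import Data.Sum using (_⊎_)
open import Data.List using (List; length)
open import Data.List.Relation.Unary.All using (All)
open import Data.List.Relation.Unary.Unique.Propositional using (Unique)
open import Data.List.Membership.Propositional using (_∈_)
open import Relation.Binary.PropositionalEquality using (_≡_; _≢_)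
open import Relation.Nullary using (¬_)
open import Function.Definitions using (Injective)

-- A finite simple graph on vertex set Fin n: a duplicate-free list of edges,
-- each edge {u,v} stored once as (u , v) with u < v (so no loops).
record Graph (n : ℕ) : Set where
  field
    edges    : List (Fin n × Fin n)
    ordered  : All (λ e → toℕ (proj₁ e) < toℕ (proj₂ e)) edges
    distinct : Unique edges
open Graph public

numEdges : ∀ {n} → Graph n → ℕ
numEdges G = length (edges G)

Adj : ∀ {n} → Graph n → Fin n → Fin n → Set
Adj G u v = ((u , v) ∈ edges G) ⊎ ((v , u) ∈ edges G)

_⊆G_ : ∀ {n} → Graph n → Graph n → Set
H ⊆G G = ∀ e → e ∈ edges H → e ∈ edges G

ContainsKrr : ℕ → ∀ {n} → Graph n → Set
ContainsKrr r {n} G =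
  Σ (Fin r → Fin n) λ a → Σ (Fin r → Fin n) λ b →
    Injective _≡_ _≡_ a × Injective _≡_ _≡_ b ×
    (∀ i j → a i ≢ b j) × (∀ i j → Adj G (a i) (b j))

KrrFree : ℕ → ∀ {n} → Graph n → Set
KrrFree r G = ¬ ContainsKrr r G

-- Colour every edge of G uniformly at random with one of K colours and keep the
-- edges of colour 0.  On average the sample has m/K edges and at most
-- copies(G)/K^(r²) copies of K_{r,r}, because the r² edges of a copy survive
-- independently.  Deleting one edge of each surviving copy leaves a K_{r,r}-free
-- graph with at least m/K − copies(G)/K^(r²) edges.  Bounding a copy by the r
-- edges a_i b_i of its matching gives copies(G) ≤ (2m)^r, and K ≈ 2 m^(1/(r+1))
-- makes the bound at least m^(r/(r+1))/4.

module Submission where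

open import Defs
open import Data.Nat using (ℕ; suc; _*_; _^_; _≤_)
open import Data.Product using (Σ; _×_)
open import Data.Nat using (>-nonZero)
open import Data.Nat.Properties using (m≤m*n)
open import Data.Product using (_,_)

module FiniteSums where

  open import Data.Nat
  open import Data.Nat.Properties
  open import Data.Fin using (Fin; zero; suc)
  open import Data.Vec.Functional using (_∷_; []; head; tail; foldr)
  open import Data.Product using (∃; _,_)
  open import Relation.Binary.Core using (_Preserves_⟶_)
  open import Relation.Binary.PropositionalEquality
    using (_≡_; refl; sym; trans; cong; cong₂; subst; _≗_; module ≡-Reasoning)
  open import Relation.Nullary using (yes; no)
  open import Function using (_∘_)
  open import Algebra.Properties.Semiring.Sum +-*-semiring
    using (sum-syntax; sum-cong-≗; ∑-distrib-+; ∑-comm; *-distribˡ-sum)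

  ∑-const : ∀ k c → ∑[ i < k ] c ≡ k * c
  ∑-const zero    c = refl
  ∑-const (suc k) c = cong (c +_) (∑-const k c)

  ∑-mono-≤ : ∀ {k} {f g : Fin k → ℕ} → (∀ i → f i ≤ g i) → ∑[ i < k ] f i ≤ ∑[ i < k ] g i
  ∑-mono-≤ {zero}  f≤g = z≤n
  ∑-mono-≤ {suc k} f≤g = +-mono-≤ (f≤g zero) (∑-mono-≤ (f≤g ∘ suc))

  ∑-*ʳ : ∀ {k} (f : Fin k → ℕ) c → (∑[ i < k ] f i) * c ≡ ∑[ i < k ] (f i * c)
  ∑-*ʳ f c = trans (*-comm _ c) (trans (*-distribˡ-sum c f) (sum-cong-≗ (λ i → *-comm c (f i))))

  ≤-∑ : ∀ {k} (f : Fin k → ℕ) i → f i ≤ ∑[ j < k ] f j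
  ≤-∑ f zero    = m≤m+n _ _
  ≤-∑ f (suc i) = ≤-trans (≤-∑ (f ∘ suc) i) (m≤n+m _ _)

  ∑-positive : ∀ {k} (f : Fin k → ℕ) → 0 < ∑[ i < k ] f i → ∃ λ i → 0 < f i
  ∑-positive {suc k} f ∑f>0 with f zero in f₀≡
  ... | suc _ = zero , subst (0 <_) (sym f₀≡) (s≤s z≤n)
  ... | zero with ∑-positive (f ∘ suc) ∑f>0
  ...   | i , fi>0 = suc i , fi>0

  ∑-≤⇒∃-≤ : ∀ {k} (f g : Fin (suc k) → ℕ) → ∑[ i < suc k ] g i ≤ ∑[ i < suc k ] f i → ∃ λ i → g i ≤ f i
  ∑-≤⇒∃-≤ f g ∑g≤∑f with g zero ≤? f zero
  ... | yes g₀≤f₀ = zero , g₀≤f₀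
  ∑-≤⇒∃-≤ {zero}  f g ∑g≤∑f | no _ =
    zero , ≤-trans (m≤m+n _ 0) (≤-trans ∑g≤∑f (≤-reflexive (+-identityʳ _)))
  ∑-≤⇒∃-≤ {suc k} f g ∑g≤∑f | no g₀≰f₀ with ∑-≤⇒∃-≤ (f ∘ suc) (g ∘ suc)
      (+-cancelˡ-≤ (f zero) _ _ (≤-trans (+-monoˡ-≤ _ (<⇒≤ (≰⇒> g₀≰f₀))) ∑g≤∑f))
  ...   | i , gi≤fi = suc i , gi≤fi

  ∑Maps : ∀ r k → ((Fin r → Fin k) → ℕ) → ℕ
  ∑Maps zero    k F = F []
  ∑Maps (suc r) k F = ∑[ x < k ] ∑Maps r k (λ a → F (x ∷ a))

  infixl 10 ∑Maps
  syntax ∑Maps r k (λ a → x) = ∑[ a ∶ r ⟶ k ] x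

  ∑Maps-cong : ∀ r {k} {F G : (Fin r → Fin k) → ℕ} → (∀ a → F a ≡ G a) →
    ∑[ a ∶ r ⟶ k ] F a ≡ ∑[ a ∶ r ⟶ k ] G a
  ∑Maps-cong zero    F≗G = F≗G []
  ∑Maps-cong (suc r) F≗G = sum-cong-≗ (λ x → ∑Maps-cong r (λ a → F≗G (x ∷ a)))

  ∑Maps-mono-≤ : ∀ r {k} {F G : (Fin r → Fin k) → ℕ} → (∀ a → F a ≤ G a) →
    ∑[ a ∶ r ⟶ k ] F a ≤ ∑[ a ∶ r ⟶ k ] G a
  ∑Maps-mono-≤ zero    F≤G = F≤G []
  ∑Maps-mono-≤ (suc r) F≤G = ∑-mono-≤ (λ x → ∑Maps-mono-≤ r (λ a → F≤G (x ∷ a)))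

  ∑Maps-distrib-+ : ∀ r {k} (F G : (Fin r → Fin k) → ℕ) →
    ∑[ a ∶ r ⟶ k ] (F a + G a) ≡ ∑[ a ∶ r ⟶ k ] F a + ∑[ a ∶ r ⟶ k ] G a
  ∑Maps-distrib-+ zero    F G = refl
  ∑Maps-distrib-+ (suc r) F G =
    trans (sum-cong-≗ (λ x → ∑Maps-distrib-+ r (F ∘ (x ∷_)) (G ∘ (x ∷_))))
          (∑-distrib-+ (λ x → ∑Maps r _ (F ∘ (x ∷_))) (λ x → ∑Maps r _ (G ∘ (x ∷_))))

  *-distribˡ-∑Maps : ∀ r {k} c (F : (Fin r → Fin k) → ℕ) →
    c * ∑[ a ∶ r ⟶ k ] F a ≡ ∑[ a ∶ r ⟶ k ] (c * F a)
  *-distribˡ-∑Maps zero    c F = refl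
  *-distribˡ-∑Maps (suc r) c F =
    trans (*-distribˡ-sum c (λ x → ∑Maps r _ (F ∘ (x ∷_))))
          (sum-cong-≗ (λ x → *-distribˡ-∑Maps r c (F ∘ (x ∷_))))

  *-distribʳ-∑Maps : ∀ r {k} c (F : (Fin r → Fin k) → ℕ) →
    (∑[ a ∶ r ⟶ k ] F a) * c ≡ ∑[ a ∶ r ⟶ k ] (F a * c)
  *-distribʳ-∑Maps r c F =
    trans (*-comm _ c) (trans (*-distribˡ-∑Maps r c F) (∑Maps-cong r (λ a → *-comm c (F a))))

  ∑Maps-const : ∀ r k c → ∑[ a ∶ r ⟶ k ] c ≡ k ^ r * c
  ∑Maps-const zero    k c = sym (+-identityʳ c)
  ∑Maps-const (suc r) k c = begin
    ∑[ x < k ] ∑[ a ∶ r ⟶ k ] c  ≡⟨ sum-cong-≗ {k} (λ _ → ∑Maps-const r k c) ⟩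
    ∑[ x < k ] (k ^ r * c)        ≡⟨ ∑-const k _ ⟩
    k * (k ^ r * c)               ≡⟨ *-assoc k (k ^ r) c ⟨
    k ^ suc r * c                 ∎
    where open ≡-Reasoning

  ∑Maps-∑-comm : ∀ r {k l} (F : (Fin r → Fin k) → Fin l → ℕ) →
    ∑[ a ∶ r ⟶ k ] ∑[ y < l ] F a y ≡ ∑[ y < l ] ∑[ a ∶ r ⟶ k ] F a y
  ∑Maps-∑-comm zero    F = refl
  ∑Maps-∑-comm (suc r) F =
    trans (sum-cong-≗ (λ x → ∑Maps-∑-comm r (F ∘ (x ∷_))))
          (∑-comm (λ x y → ∑Maps r _ (λ a → F (x ∷ a) y)))

  ∑Maps-comm : ∀ r s {k l} (F : (Fin r → Fin k) → (Fin s → Fin l) → ℕ) →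
    ∑[ a ∶ r ⟶ k ] ∑[ b ∶ s ⟶ l ] F a b ≡ ∑[ b ∶ s ⟶ l ] ∑[ a ∶ r ⟶ k ] F a b
  ∑Maps-comm r zero    F = refl
  ∑Maps-comm r (suc s) F =
    trans (∑Maps-∑-comm r (λ a y → ∑Maps s _ (F a ∘ (y ∷_))))
          (sum-cong-≗ (λ y → ∑Maps-comm r s (λ a b → F a (y ∷ b))))

  ∑Maps-positive : ∀ r {k} (F : (Fin r → Fin k) → ℕ) → 0 < ∑[ a ∶ r ⟶ k ] F a → ∃ λ a → 0 < F a
  ∑Maps-positive zero    F ∑F>0 = [] , ∑F>0
  ∑Maps-positive (suc r) F ∑F>0 with ∑-positive _ ∑F>0
  ... | x , p with ∑Maps-positive r (F ∘ (x ∷_)) p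
  ...   | a , Fa>0 = x ∷ a , Fa>0

  ∑Maps-≤⇒∃-≤ : ∀ r {k} (F G : (Fin r → Fin (suc k)) → ℕ) →
    ∑[ a ∶ r ⟶ suc k ] G a ≤ ∑[ a ∶ r ⟶ suc k ] F a → ∃ λ a → G a ≤ F a
  ∑Maps-≤⇒∃-≤ zero    F G ∑G≤∑F = [] , ∑G≤∑F
  ∑Maps-≤⇒∃-≤ (suc r) F G ∑G≤∑F with ∑-≤⇒∃-≤ _ _ ∑G≤∑F
  ... | x , p with ∑Maps-≤⇒∃-≤ r (F ∘ (x ∷_)) (G ∘ (x ∷_)) p
  ...   | a , Ga≤Fa = x ∷ a , Ga≤Fa

  -- a and head a ∷ tail a are only pointwise equal, hence the hypothesis on F.
  ≤-∑Maps : ∀ r {k} (F : (Fin r → Fin k) → ℕ) → F Preserves _≗_ ⟶ _≡_ →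
    ∀ a → F a ≤ ∑[ b ∶ r ⟶ k ] F b
  ≤-∑Maps zero    F F-resp a = ≤-reflexive (F-resp (λ ()))
  ≤-∑Maps (suc r) F F-resp a = begin
    F a                               ≡⟨ F-resp (λ { zero → refl ; (suc i) → refl }) ⟩
    F (head a ∷ tail a)               ≤⟨ ≤-∑Maps r (F ∘ (head a ∷_))
                                           (λ a≗b → F-resp λ { zero → refl ; (suc i) → a≗b i }) (tail a) ⟩
    ∑Maps r _ (F ∘ (head a ∷_))       ≤⟨ ≤-∑ (λ x → ∑Maps r _ (F ∘ (x ∷_))) (head a) ⟩
    ∑Maps (suc r) _ F                 ∎
    where open ≤-Reasoning

  ∑Maps-mono-< : ∀ r {k} {F G : (Fin r → Fin k) → ℕ} →
    F Preserves _≗_ ⟶ _≡_ → G Preserves _≗_ ⟶ _≡_ →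
    (∀ a → F a ≤ G a) → ∀ a → F a < G a → ∑[ b ∶ r ⟶ k ] F b < ∑[ b ∶ r ⟶ k ] G b
  ∑Maps-mono-< r {F = F} {G} F-resp G-resp F≤G a Fa<Ga = begin-strict
    ∑Maps r _ F                                 <⟨ m<m+n (∑Maps r _ F) 0<∑D ⟩
    ∑Maps r _ F + ∑Maps r _ D                   ≡⟨ ∑Maps-distrib-+ r F D ⟨
    ∑[ b ∶ r ⟶ _ ] (F b + D b)                  ≡⟨ ∑Maps-cong r (λ b → m+[n∸m]≡n (F≤G b)) ⟩
    ∑Maps r _ G                                 ∎
    where
    open ≤-Reasoning
    D : _ → ℕ
    D b = G b ∸ F b
    0<∑D : 0 < ∑Maps r _ D
    0<∑D = <-≤-trans (m<n⇒0<n∸m Fa<Ga) (≤-∑Maps r D (λ a≗b → cong₂ _∸_ (G-resp a≗b) (F-resp a≗b)) a)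

  ∏ : ∀ {r} → (Fin r → ℕ) → ℕ
  ∏ = foldr _*_ 1

  ∏-positive : ∀ {r} (f : Fin r → ℕ) → (∀ i → 0 < f i) → 0 < ∏ f
  ∏-positive {zero}  f f>0 = s≤s z≤n
  ∏-positive {suc r} f f>0 = *-mono-≤ (f>0 zero) (∏-positive (f ∘ suc) (f>0 ∘ suc))

  ∏-cong : ∀ {r} {f g : Fin r → ℕ} → (∀ i → f i ≡ g i) → ∏ f ≡ ∏ g
  ∏-cong {zero}  f≗g = refl
  ∏-cong {suc r} f≗g = cong₂ _*_ (f≗g zero) (∏-cong (f≗g ∘ suc))

  ∏-const : ∀ r c → ∏ {r} (λ _ → c) ≡ c ^ r
  ∏-const zero    c = refl
  ∏-const (suc r) c = cong (c *_) (∏-const r c)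

  ∑Maps-∏ : ∀ r {k} (f : Fin r → Fin k → ℕ) →
    ∑[ a ∶ r ⟶ k ] ∏ (λ i → f i (a i)) ≡ ∏ (λ i → ∑[ x < k ] f i x)
  ∑Maps-∏ zero    f = refl
  ∑Maps-∏ (suc r) {k} f = begin
    ∑[ x < k ] ∑[ a ∶ r ⟶ k ] (f zero x * P a)   ≡⟨ sum-cong-≗ {k} (λ x → *-distribˡ-∑Maps r (f zero x) P) ⟨
    ∑[ x < k ] (f zero x * ∑Maps r k P)          ≡⟨ ∑-*ʳ (f zero) _ ⟨
    (∑[ x < k ] f zero x) * ∑Maps r k P          ≡⟨ cong ((∑[ x < k ] f zero x) *_) (∑Maps-∏ r (f ∘ suc)) ⟩
    (∑[ x < k ] f zero x) * ∏ (λ i → ∑[ x < k ] f (suc i) x)  ∎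
    where
    open ≡-Reasoning
    P : (Fin r → Fin k) → ℕ
    P a = ∏ (λ i → f (suc i) (a i))

module Indicators where

  open import Data.Nat hiding (_≟_)
  open import Data.Nat.Properties hiding (_≟_; suc-injective)
  open import Data.Fin using (Fin; zero; suc)
  open import Data.Fin.Properties using (_≟_; suc-injective)
  open import Data.Product using (_×_; proj₁; proj₂)
  open import Data.Sum using (_⊎_; inj₁; inj₂)
  open import Relation.Binary.PropositionalEquality using (_≡_; trans; cong)
  open import Relation.Nullary using (Dec; yes; no; ¬_; contradiction)
  open import Function using (case_of_)
  open import Algebra.Properties.Semiring.Sum +-*-semiring using (sum-syntax; sum-cong-≗)
  open FiniteSums

  private
    variable
      A B : Set

  𝟙 : Dec A → ℕ
  𝟙 (yes _) = 1
  𝟙 (no _)  = 0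

  𝟙-≤ : (a? : Dec A) {n : ℕ} → (A → 0 < n) → 𝟙 a? ≤ n
  𝟙-≤ (yes a) A⇒n>0 = A⇒n>0 a
  𝟙-≤ (no _)  A⇒n>0 = z≤n

  𝟙-mono : (a? : Dec A) (b? : Dec B) → (A → B) → 𝟙 a? ≤ 𝟙 b?
  𝟙-mono a? (yes _) A⇒B = 𝟙-≤ a? (λ _ → s≤s z≤n)
  𝟙-mono a? (no ¬b) A⇒B = 𝟙-≤ a? (λ a → contradiction (A⇒B a) ¬b)

  𝟙-cong : (a? : Dec A) (b? : Dec B) → (A → B) → (B → A) → 𝟙 a? ≡ 𝟙 b?
  𝟙-cong a? b? A⇒B B⇒A = ≤-antisym (𝟙-mono a? b? A⇒B) (𝟙-mono b? a? B⇒A)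

  𝟙-< : (a? : Dec A) (b? : Dec B) → ¬ A → B → 𝟙 a? < 𝟙 b?
  𝟙-< (no _)  (yes _) ¬a b = s≤s z≤n
  𝟙-< (yes a) _       ¬a b = contradiction a ¬a
  𝟙-< _       (no ¬b) ¬a b = contradiction b ¬b

  𝟙-positive⁺ : (a? : Dec A) → A → 0 < 𝟙 a?
  𝟙-positive⁺ (yes _) _ = s≤s z≤n
  𝟙-positive⁺ (no ¬a) a = contradiction a ¬a

  𝟙-positive⁻ : (a? : Dec A) → 0 < 𝟙 a? → A
  𝟙-positive⁻ (yes a) _ = a

  𝟙-≤-+ : ∀ {C : Set} (a? : Dec A) (b? : Dec B) (c? : Dec C) → (A → B ⊎ C) → 𝟙 a? ≤ 𝟙 b? + 𝟙 c?
  𝟙-≤-+ a? b? c? A⇒B⊎C = 𝟙-≤ a? λ a → case A⇒B⊎C a of λ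
    { (inj₁ b) → <-≤-trans (𝟙-positive⁺ b? b) (m≤m+n _ _)
    ; (inj₂ c) → <-≤-trans (𝟙-positive⁺ c? c) (m≤n+m _ _) }

  𝟙-≤-* : ∀ {C : Set} (a? : Dec A) (b? : Dec B) (c? : Dec C) → (A → B × C) → 𝟙 a? ≤ 𝟙 b? * 𝟙 c?
  𝟙-≤-* a? b? c? A⇒B×C = 𝟙-≤ a? λ a →
    *-mono-≤ (𝟙-positive⁺ b? (proj₁ (A⇒B×C a))) (𝟙-positive⁺ c? (proj₂ (A⇒B×C a)))

  ∑-𝟙≟ : ∀ {k} (u : Fin k) → ∑[ x < k ] 𝟙 (x ≟ u) ≡ 1
  ∑-𝟙≟ {suc k} zero    = cong suc (trans (∑-const k 0) (*-zeroʳ k))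
  ∑-𝟙≟ {suc k} (suc u) = trans (sum-cong-≗ {k} λ x →
    𝟙-cong (suc x ≟ suc u) (x ≟ u) suc-injective (cong suc)) (∑-𝟙≟ u)

module Colourings where

  open import Data.Nat
  open import Data.Nat.Properties hiding (suc-injective)
  open import Data.Bool using (Bool; true; false; if_then_else_)
  open import Data.Fin using (Fin; zero; suc)
  open import Data.Fin.Properties using (suc-injective; injective⇒≤)
  open import Relation.Binary.PropositionalEquality
    using (_≡_; refl; trans; cong; module ≡-Reasoning)
  open import Function using (_∘_; case_of_)
  open import Function.Definitions using (Injective)
  open import Algebra.Properties.Semiring.Sum +-*-semiring using (sum-syntax; sum-cong-≗; *-distribˡ-sum)
  open import Algebra.Properties.CommutativeSemigroup *-commutativeSemigroup using (x∙yz≈y∙xz)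
  open FiniteSums

  count : ∀ {m} → (Fin m → Bool) → ℕ
  count {m} T = ∑[ p < m ] (if T p then 1 else 0)

  rank : ∀ {m} (T : Fin m → Bool) (p : Fin m) → T p ≡ true → Fin (count T)
  rank T zero    Tp with T zero
  ... | true = zero
  rank T (suc p) Tp with T zero
  ... | true  = suc (rank (T ∘ suc) p Tp)
  ... | false = rank (T ∘ suc) p Tp

  rank-injective : ∀ {m} (T : Fin m → Bool) {p q} (Tp : T p ≡ true) (Tq : T q ≡ true) →
    rank T p Tp ≡ rank T q Tq → p ≡ q
  rank-injective T {zero}  {zero}  Tp Tq eq = refl
  rank-injective T {zero}  {suc q} Tp Tq eq with T zero
  ... | true = case eq of λ ()
  rank-injective T {suc p} {zero}  Tp Tq eq with T zero
  ... | true = case eq of λ ()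
  rank-injective T {suc p} {suc q} Tp Tq eq with T zero
  ... | true  = cong suc (rank-injective (T ∘ suc) Tp Tq (suc-injective eq))
  ... | false = cong suc (rank-injective (T ∘ suc) Tp Tq eq)

  count-≥ : ∀ {m k} (T : Fin m → Bool) (g : Fin k → Fin m) → Injective _≡_ _≡_ g →
    (∀ x → T (g x) ≡ true) → k ≤ count T
  count-≥ T g g-inj T∘g = injective⇒≤ (g-inj ∘ rank-injective T (T∘g _) (T∘g _))

  module _ {D : ℕ} where

    private
      K = suc D

    isZero : Fin K → ℕ
    isZero zero    = 1
    isZero (suc _) = 0

    ∑-isZero : ∑[ x < K ] isZero x ≡ 1
    ∑-isZero = cong suc (trans (∑-const D 0) (*-zeroʳ D))

    ∑Maps-isZero : ∀ m (p : Fin m) → (∑[ c ∶ m ⟶ K ] isZero (c p)) * K ≡ K ^ m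
    ∑Maps-isZero (suc m) zero = begin
      (∑[ x < K ] ∑[ a ∶ m ⟶ K ] isZero x) * K
        ≡⟨ cong (_* K) (sum-cong-≗ {K} (λ x → ∑Maps-const m K (isZero x))) ⟩
      (∑[ x < K ] (K ^ m * isZero x)) * K       ≡⟨ cong (_* K) (*-distribˡ-sum (K ^ m) isZero) ⟨
      K ^ m * (∑[ x < K ] isZero x) * K         ≡⟨ cong (λ s → K ^ m * s * K) ∑-isZero ⟩
      K ^ m * 1 * K                             ≡⟨ cong (_* K) (*-identityʳ (K ^ m)) ⟩
      K ^ m * K                                 ≡⟨ *-comm (K ^ m) K ⟩
      K ^ suc m                                 ∎
      where open ≡-Reasoning
    ∑Maps-isZero (suc m) (suc p) = begin
      (∑[ x < K ] ∑[ a ∶ m ⟶ K ] isZero (a p)) * K  ≡⟨ cong (_* K) (∑-const K S) ⟩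
      K * S * K                                     ≡⟨ *-assoc K S K ⟩
      K * (S * K)                                   ≡⟨ cong (K *_) (∑Maps-isZero m p) ⟩
      K ^ suc m                                     ∎
      where
      open ≡-Reasoning
      S = ∑[ a ∶ m ⟶ K ] isZero (a p)

    zeroOn : ∀ {m} → (Fin m → Bool) → (Fin m → Fin K) → ℕ
    zeroOn T c = ∏ (λ p → if T p then isZero (c p) else 1)

    ∑Maps-zeroOn : ∀ m (T : Fin m → Bool) → (∑[ c ∶ m ⟶ K ] zeroOn T c) * K ^ count T ≡ K ^ m
    ∑Maps-zeroOn m T = begin
      (∑[ c ∶ m ⟶ K ] zeroOn T c) * K ^ count T    ≡⟨ cong (_* K ^ count T) (∑Maps-∏ m weight) ⟩
      ∏ (λ p → ∑[ x < K ] weight p x) * K ^ count T ≡⟨ cong (_* K ^ count T) (∏-cong ∑-weight) ⟩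
      ∏ (λ p → if T p then 1 else K) * K ^ count T  ≡⟨ ∏-weight m T ⟩
      K ^ m                                         ∎
      where
      open ≡-Reasoning
      weight : Fin m → Fin K → ℕ
      weight p x = if T p then isZero x else 1
      ∑-weight : ∀ p → ∑[ x < K ] weight p x ≡ (if T p then 1 else K)
      ∑-weight p with T p
      ... | true  = ∑-isZero
      ... | false = trans (∑-const K 1) (*-identityʳ K)
      ∏-weight : ∀ m (T : Fin m → Bool) → ∏ (λ p → if T p then 1 else K) * K ^ count T ≡ K ^ m
      ∏-weight zero    T = refl
      ∏-weight (suc m) T with T zero
      ... | true  = trans (cong (_* (K * K ^ count (T ∘ suc))) (+-identityʳ P))
                          (trans (x∙yz≈y∙xz P K _) (cong (K *_) (∏-weight m (T ∘ suc))))
        where P = ∏ (λ p → if T (suc p) then 1 else K)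
      ... | false = trans (*-assoc K P _) (cong (K *_) (∏-weight m (T ∘ suc)))
        where P = ∏ (λ p → if T (suc p) then 1 else K)

    zeroOn-positive : ∀ {m} (T : Fin m → Bool) c → (∀ p → T p ≡ true → c p ≡ zero) → 0 < zeroOn T c
    zeroOn-positive T c zero-on-T = ∏-positive _ positive
      where
      positive : ∀ p → 0 < (if T p then isZero (c p) else 1)
      positive p with T p in Tp
      ... | false = s≤s z≤n
      ... | true with c p | zero-on-T p Tp
      ...   | zero | _ = s≤s z≤n

module ListSelection where

  open import Data.Nat
  open import Data.Fin using (Fin; zero; suc)
  open import Data.List using (List; []; _∷_; length; lookup)
  open import Data.List.Relation.Unary.All as All using (All; []; _∷_)
  open import Data.List.Relation.Unary.Any using (here; there)
  open import Data.List.Relation.Unary.AllPairs using ([]; _∷_)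
  open import Data.List.Relation.Unary.Unique.Propositional using (Unique)
  open import Data.List.Membership.Propositional using (_∈_)
  open import Data.List.Membership.Propositional.Properties using (∈-lookup)
  open import Data.Product using (∃; _×_; _,_)
  open import Relation.Binary.PropositionalEquality using (_≡_; refl; sym; cong)
  open import Relation.Nullary using (contradiction)
  open import Function using (_∘_)
  open import Data.Nat.Properties using (+-*-semiring)
  open import Algebra.Properties.Semiring.Sum +-*-semiring using (sum-syntax)
  open Colourings using (isZero)

  module _ {A : Set} where

    lookup-injective : ∀ {xs : List A} → Unique xs → ∀ {i j} → lookup xs i ≡ lookup xs j → i ≡ j
    lookup-injective {x ∷ xs} (x∉xs ∷ u) {zero}  {zero}  eq = refl
    lookup-injective {x ∷ xs} (x∉xs ∷ u) {zero}  {suc j} eq =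
      contradiction eq (All.lookup x∉xs (∈-lookup j))
    lookup-injective {x ∷ xs} (x∉xs ∷ u) {suc i} {zero}  eq =
      contradiction (sym eq) (All.lookup x∉xs (∈-lookup i))
    lookup-injective {x ∷ xs} (x∉xs ∷ u) {suc i} {suc j} eq = cong suc (lookup-injective u eq)

    module _ {D : ℕ} where

      keepIfZero : Fin (suc D) → A → List A → List A
      keepIfZero zero    x xs = x ∷ xs
      keepIfZero (suc _) x xs = xs

      keep : (xs : List A) → (Fin (length xs) → Fin (suc D)) → List A
      keep []       c = []
      keep (x ∷ xs) c = keepIfZero (c zero) x (keep xs (c ∘ suc))

      length-keep : ∀ xs c → length (keep xs c) ≡ ∑[ p < length xs ] isZero (c p)
      length-keep []       c = refl
      length-keep (x ∷ xs) c with c zero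
      ... | zero  = cong suc (length-keep xs (c ∘ suc))
      ... | suc _ = length-keep xs (c ∘ suc)

      keep⁺ : ∀ {P : A → Set} {xs} c → All P xs → All P (keep xs c)
      keep⁺ {xs = []}     c []         = []
      keep⁺ {xs = x ∷ xs} c (px ∷ pxs) with c zero
      ... | zero  = px ∷ keep⁺ (c ∘ suc) pxs
      ... | suc _ = keep⁺ (c ∘ suc) pxs

      keep-Unique : ∀ {xs} c → Unique xs → Unique (keep xs c)
      keep-Unique {[]}     c []           = []
      keep-Unique {x ∷ xs} c (x∉xs ∷ u) with c zero
      ... | zero  = keep⁺ (c ∘ suc) x∉xs ∷ keep-Unique (c ∘ suc) u
      ... | suc _ = keep-Unique (c ∘ suc) u

      ∈-keep⁻ : ∀ xs {y} c → y ∈ keep xs c → ∃ λ p → lookup xs p ≡ y × c p ≡ zero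
      ∈-keep⁻ (x ∷ xs) c y∈ with c zero in c₀≡
      ∈-keep⁻ (x ∷ xs) c (here refl) | zero = zero , refl , c₀≡
      ∈-keep⁻ (x ∷ xs) c (there y∈)  | zero with ∈-keep⁻ xs (c ∘ suc) y∈
      ... | p , eq , cp≡0 = suc p , eq , cp≡0
      ∈-keep⁻ (x ∷ xs) c y∈          | suc _ with ∈-keep⁻ xs (c ∘ suc) y∈
      ... | p , eq , cp≡0 = suc p , eq , cp≡0

      keep-⊆ : ∀ xs {y} c → y ∈ keep xs c → y ∈ xs
      keep-⊆ xs c y∈ with ∈-keep⁻ xs c y∈
      ... | p , refl , _ = ∈-lookup p

module KrrCopies where

  open import Data.Nat hiding (_≟_)
  open import Data.Nat.Properties hiding (_≟_)
  open import Data.Nat.Induction using (<-wellFounded)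
  open import Induction.WellFounded using (Acc; acc)
  open import Data.Fin using (Fin; zero; suc)
  open import Data.Fin.Properties using (_≟_; all?)
  open import Data.List using (List; []; _∷_; length; filter)
  open import Data.List.Properties using (filter-accept; filter-reject; filter-all)
  open import Data.List.Relation.Unary.All as All using (All)
  open import Data.List.Relation.Unary.All.Properties as All using ()
  open import Data.List.Relation.Unary.Any using (here; there)
  open import Data.List.Relation.Unary.AllPairs using (_∷_)
  open import Data.List.Relation.Unary.Unique.Propositional using (Unique)
  open import Data.List.Relation.Unary.Unique.Propositional.Properties as Unique using ()
  open import Data.List.Membership.Propositional using (_∈_; _∉_)
  open import Data.List.Membership.Propositional.Properties using (∈-filter⁻)
  open import Data.List.Membership.DecPropositional using (_∈?_)
  open import Data.Product using (Σ; _×_; _,_; proj₁; proj₂)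
  open import Data.Product.Properties using (≡-dec)
  open import Data.Sum using (_⊎_; inj₁; inj₂)
  import Data.Sum as Sum
  open import Relation.Binary.Core using (_Preserves_⟶_)
  open import Relation.Binary.PropositionalEquality
    using (_≡_; _≢_; refl; sym; trans; cong; subst; subst₂; _≗_)
  open import Relation.Nullary using (Dec; ¬_)
  open import Relation.Nullary.Decidable using (map′; ¬?; _×-dec_; _⊎-dec_; _→-dec_)
  open import Function using (_∘_)
  open import Function.Definitions using (Injective)
  open import Algebra.Properties.Semiring.Sum +-*-semiring
    using (sum-syntax; sum-cong-≗; ∑-distrib-+; ∑-comm; *-distribˡ-sum)
  open FiniteSums
  open Indicators

  Edge : ℕ → Set
  Edge n = Fin n × Fin n

  module _ {n : ℕ} where

    _≟E_ : (e f : Edge n) → Dec (e ≡ f)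
    _≟E_ = ≡-dec _≟_ _≟_

    _∈E?_ : (e : Edge n) (E : List (Edge n)) → Dec (e ∈ E)
    _∈E?_ = _∈?_ _≟E_

    adj? : (G : Graph n) → ∀ u v → Dec (Adj G u v)
    adj? G u v = ((u , v) ∈E? edges G) ⊎-dec ((v , u) ∈E? edges G)

    Adj-mono : ∀ {H G : Graph n} → H ⊆G G → ∀ {u v} → Adj H u v → Adj G u v
    Adj-mono H⊆G = Sum.map (H⊆G _) (H⊆G _)

    ∈-edges-asym : ∀ (G : Graph n) {u v} → (u , v) ∈ edges G → (v , u) ∉ edges G
    ∈-edges-asym G uv∈ vu∈ = <-asym (All.lookup (ordered G) uv∈) (All.lookup (ordered G) vu∈)

    removeEdge : Graph n → Edge n → Graph n
    removeEdge G e = record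
      { edges    = filter (λ f → ¬? (f ≟E e)) (edges G)
      ; ordered  = All.filter⁺ _ (ordered G)
      ; distinct = Unique.filter⁺ _ (distinct G)
      }

    removeEdge-⊆ : ∀ G e → removeEdge G e ⊆G G
    removeEdge-⊆ G e f f∈ = proj₁ (∈-filter⁻ (λ f → ¬? (f ≟E e)) {xs = edges G} f∈)

    length-removeEdge : ∀ G {e} → e ∈ edges G → numEdges G ≡ suc (numEdges (removeEdge G e))
    length-removeEdge G = go (distinct G)
      where
      go : ∀ {xs e} → Unique xs → e ∈ xs → length xs ≡ suc (length (filter (λ f → ¬? (f ≟E e)) xs))
      go {x ∷ xs} (x∉xs ∷ _) (here refl) = cong (suc ∘ length) (sym (trans
        (filter-reject (λ f → ¬? (f ≟E x)) {xs = xs} (λ x≢x → x≢x refl))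
        (filter-all (λ f → ¬? (f ≟E x)) (All.map (λ x≢f f≡x → x≢f (sym f≡x)) x∉xs))))
      go {x ∷ xs} {e} (x∉xs ∷ u) (there e∈) = cong suc (trans (go u e∈) (cong length (sym
        (filter-accept (λ f → ¬? (f ≟E e)) {xs = xs} (All.lookup x∉xs e∈)))))

    removeEdge-¬Adj : ∀ G {u v} → (u , v) ∈ edges G → ¬ Adj (removeEdge G (u , v)) u v
    removeEdge-¬Adj G {u} {v} uv∈ (inj₁ uv∈′) =
      proj₂ (∈-filter⁻ (λ f → ¬? (f ≟E (u , v))) {xs = edges G} uv∈′) refl
    removeEdge-¬Adj G uv∈ (inj₂ vu∈′) = ∈-edges-asym G uv∈ (removeEdge-⊆ G _ _ vu∈′)

    cutEdge : ∀ G {u v} → Adj G u v → Σ (Edge n) λ e → e ∈ edges G × ¬ Adj (removeEdge G e) u v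
    cutEdge G (inj₁ uv∈) = _ , uv∈ , removeEdge-¬Adj G uv∈
    cutEdge G (inj₂ vu∈) = _ , vu∈ , removeEdge-¬Adj G vu∈ ∘ Sum.swap

  module _ {n : ℕ} (r : ℕ) where

    IsKrr : Graph n → (Fin r → Fin n) → (Fin r → Fin n) → Set
    IsKrr G a b = Injective _≡_ _≡_ a × Injective _≡_ _≡_ b ×
                  (∀ i j → a i ≢ b j) × (∀ i j → Adj G (a i) (b j))

    injective? : (a : Fin r → Fin n) → Dec (Injective _≡_ _≡_ a)
    injective? a = map′ (λ inj {i} {j} → inj i j) (λ inj i j → inj)
                        (all? λ i → all? λ j → (a i ≟ a j) →-dec (i ≟ j))

    isKrr? : ∀ G a b → Dec (IsKrr G a b)
    isKrr? G a b = injective? a ×-dec injective? b ×-dec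
                   all? (λ i → all? λ j → ¬? (a i ≟ b j)) ×-dec
                   all? (λ i → all? λ j → adj? G (a i) (b j))

    IsKrr-resp : ∀ {G a a′ b b′} → a ≗ a′ → b ≗ b′ → IsKrr G a b → IsKrr G a′ b′
    IsKrr-resp {G} a≗a′ b≗b′ (a-inj , b-inj , a≢b , adj) =
      (λ eq → a-inj (trans (a≗a′ _) (trans eq (sym (a≗a′ _))))) ,
      (λ eq → b-inj (trans (b≗b′ _) (trans eq (sym (b≗b′ _))))) ,
      (λ i j eq → a≢b i j (trans (a≗a′ i) (trans eq (sym (b≗b′ j))))) ,
      (λ i j → subst₂ (Adj G) (a≗a′ i) (b≗b′ j) (adj i j))

    IsKrr-mono : ∀ {H G} → H ⊆G G → ∀ {a b} → IsKrr H a b → IsKrr G a b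
    IsKrr-mono {H} {G} H⊆G (a-inj , b-inj , a≢b , adj) =
      a-inj , b-inj , a≢b , λ i j → Adj-mono {H = H} {G} H⊆G (adj i j)

    copiesAt : Graph n → (Fin r → Fin n) → ℕ
    copiesAt G a = ∑[ b ∶ r ⟶ n ] 𝟙 (isKrr? G a b)

    copies : Graph n → ℕ
    copies G = ∑[ a ∶ r ⟶ n ] copiesAt G a

    𝟙-isKrr-resp : ∀ G a → (λ b → 𝟙 (isKrr? G a b)) Preserves _≗_ ⟶ _≡_
    𝟙-isKrr-resp G a {b} {b′} b≗b′ = 𝟙-cong (isKrr? G a b) (isKrr? G a b′)
      (IsKrr-resp {G} (λ _ → refl) b≗b′) (IsKrr-resp {G} (λ _ → refl) (sym ∘ b≗b′))

    copiesAt-resp : ∀ G → copiesAt G Preserves _≗_ ⟶ _≡_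
    copiesAt-resp G {a} {a′} a≗a′ = ∑Maps-cong r λ b → 𝟙-cong (isKrr? G a b) (isKrr? G a′ b)
      (IsKrr-resp {G} a≗a′ (λ _ → refl)) (IsKrr-resp {G} (sym ∘ a≗a′) (λ _ → refl))

    copies-positive : ∀ {G a b} → IsKrr G a b → 0 < copies G
    copies-positive {G} {a} {b} krr = begin-strict
      0                       <⟨ 𝟙-positive⁺ (isKrr? G a b) krr ⟩
      𝟙 (isKrr? G a b)        ≤⟨ ≤-∑Maps r _ (𝟙-isKrr-resp G a) b ⟩
      copiesAt G a            ≤⟨ ≤-∑Maps r _ (copiesAt-resp G) a ⟩
      copies G                ∎
      where open ≤-Reasoning

    KrrFree⊎ContainsKrr : ∀ G → KrrFree r G ⊎ ContainsKrr r G
    KrrFree⊎ContainsKrr G with copies G in copies≡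
    ... | zero  = inj₁ λ (_ , _ , krr) → <-irrefl (sym copies≡) (copies-positive {G} krr)
    ... | suc _ with ∑Maps-positive r (copiesAt G) (subst (0 <_) (sym copies≡) (s≤s z≤n))
    ...   | a , copiesAt>0 with ∑Maps-positive r _ copiesAt>0
    ...     | b , 𝟙>0 = inj₂ (a , b , 𝟙-positive⁻ (isKrr? G a b) 𝟙>0)

    copies-mono-< : ∀ {H G} → H ⊆G G → ∀ {a b} → ¬ IsKrr H a b → IsKrr G a b → copies H < copies G
    copies-mono-< {H} {G} H⊆G {a} {b} ¬krrH krrG =
      ∑Maps-mono-< r (copiesAt-resp H) (copiesAt-resp G) copiesAt-mono a
        (∑Maps-mono-< r (𝟙-isKrr-resp H a) (𝟙-isKrr-resp G a) (𝟙-isKrr-mono a) b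
          (𝟙-< (isKrr? H a b) (isKrr? G a b) ¬krrH krrG))
      where
      𝟙-isKrr-mono : ∀ a b → 𝟙 (isKrr? H a b) ≤ 𝟙 (isKrr? G a b)
      𝟙-isKrr-mono a b = 𝟙-mono (isKrr? H a b) (isKrr? G a b) (IsKrr-mono {H} {G} H⊆G)
      copiesAt-mono : ∀ a → copiesAt H a ≤ copiesAt G a
      copiesAt-mono a = ∑Maps-mono-≤ r (𝟙-isKrr-mono a)

  KrrFree-subgraph : ∀ {n} r (G : Graph n) →
    Σ (Graph n) λ H → H ⊆G G × KrrFree (suc r) H × numEdges G ≤ numEdges H + copies (suc r) G
  KrrFree-subgraph {n} r G = go G (<-wellFounded (numEdges G))
    where
    go : ∀ G → Acc _<_ (numEdges G) →
         Σ (Graph n) λ H → H ⊆G G × KrrFree (suc r) H × numEdges G ≤ numEdges H + copies (suc r) G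
    go G (acc rec) with KrrFree⊎ContainsKrr (suc r) G
    ... | inj₁ free = G , (λ _ e∈ → e∈) , free , m≤m+n _ _
    ... | inj₂ (a , b , krr@(_ , _ , _ , adj)) with cutEdge G (adj zero zero)
    ...   | e , e∈ , ¬adj with go (removeEdge G e) (rec (≤-reflexive (sym (length-removeEdge G e∈))))
    ...     | H , H⊆G-e , free , |G-e|≤ = H , (λ f → removeEdge-⊆ G e f ∘ H⊆G-e f) , free , bound
      where
      fewer : copies (suc r) (removeEdge G e) < copies (suc r) G
      fewer = copies-mono-< (suc r) {removeEdge G e} {G} (removeEdge-⊆ G e)
                (λ (_ , _ , _ , adj′) → ¬adj (adj′ zero zero)) krr
      bound : numEdges G ≤ numEdges H + copies (suc r) G
      bound = begin
        numEdges G                                              ≡⟨ length-removeEdge G e∈ ⟩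
        suc (numEdges (removeEdge G e))                         ≤⟨ s≤s |G-e|≤ ⟩
        suc (numEdges H + copies (suc r) (removeEdge G e))      ≡⟨ +-suc _ _ ⟨
        numEdges H + suc (copies (suc r) (removeEdge G e))      ≤⟨ +-monoʳ-≤ (numEdges H) fewer ⟩
        numEdges H + copies (suc r) G                           ∎
        where open ≤-Reasoning

  module _ {n : ℕ} where

    private
      ∑∑-distrib-+ : (f g : Fin n → Fin n → ℕ) →
        ∑[ x < n ] ∑[ y < n ] (f x y + g x y) ≡ ∑[ x < n ] ∑[ y < n ] f x y + ∑[ x < n ] ∑[ y < n ] g x y
      ∑∑-distrib-+ f g = trans (sum-cong-≗ {n} λ x → ∑-distrib-+ (f x) (g x))
                               (∑-distrib-+ (λ x → ∑[ y < n ] f x y) (λ x → ∑[ y < n ] g x y))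

    ∑∑-𝟙≟E : (e : Edge n) → ∑[ x < n ] ∑[ y < n ] 𝟙 ((x , y) ≟E e) ≤ 1
    ∑∑-𝟙≟E (u , v) = begin
      ∑[ x < n ] ∑[ y < n ] 𝟙 ((x , y) ≟E (u , v))
        ≤⟨ ∑-mono-≤ (λ x → ∑-mono-≤ λ y →
             𝟙-≤-* ((x , y) ≟E (u , v)) (x ≟ u) (y ≟ v) λ { refl → refl , refl }) ⟩
      ∑[ x < n ] ∑[ y < n ] (𝟙 (x ≟ u) * 𝟙 (y ≟ v))
        ≡⟨ sum-cong-≗ {n} (λ x → *-distribˡ-sum (𝟙 (x ≟ u)) (λ y → 𝟙 (y ≟ v))) ⟨
      ∑[ x < n ] (𝟙 (x ≟ u) * ∑[ y < n ] 𝟙 (y ≟ v))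
        ≡⟨ sum-cong-≗ {n} (λ x → trans (cong (𝟙 (x ≟ u) *_) (∑-𝟙≟ v)) (*-identityʳ _)) ⟩
      ∑[ x < n ] 𝟙 (x ≟ u)
        ≡⟨ ∑-𝟙≟ u ⟩
      1 ∎
      where open ≤-Reasoning

    ∑∑-𝟙∈ : (E : List (Edge n)) → ∑[ x < n ] ∑[ y < n ] 𝟙 ((x , y) ∈E? E) ≤ length E
    ∑∑-𝟙∈ []      = ≤-reflexive (trans (sum-cong-≗ {n} λ _ → trans (∑-const n 0) (*-zeroʳ n))
                                       (trans (∑-const n 0) (*-zeroʳ n)))
    ∑∑-𝟙∈ (e ∷ E) = begin
      ∑[ x < n ] ∑[ y < n ] 𝟙 ((x , y) ∈E? (e ∷ E))
        ≤⟨ ∑-mono-≤ (λ x → ∑-mono-≤ λ y → 𝟙-≤-+ ((x , y) ∈E? (e ∷ E)) ((x , y) ≟E e) ((x , y) ∈E? E)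
             λ { (here xy≡e) → inj₁ xy≡e ; (there xy∈E) → inj₂ xy∈E }) ⟩
      ∑[ x < n ] ∑[ y < n ] (𝟙 ((x , y) ≟E e) + 𝟙 ((x , y) ∈E? E))
        ≡⟨ ∑∑-distrib-+ _ _ ⟩
      ∑[ x < n ] ∑[ y < n ] 𝟙 ((x , y) ≟E e) + ∑[ x < n ] ∑[ y < n ] 𝟙 ((x , y) ∈E? E)
        ≤⟨ +-mono-≤ (∑∑-𝟙≟E e) (∑∑-𝟙∈ E) ⟩
      suc (length E) ∎
      where open ≤-Reasoning

    ∑∑-𝟙adj : (G : Graph n) → ∑[ x < n ] ∑[ y < n ] 𝟙 (adj? G x y) ≤ 2 * numEdges G
    ∑∑-𝟙adj G = begin
      ∑[ x < n ] ∑[ y < n ] 𝟙 (adj? G x y)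
        ≤⟨ ∑-mono-≤ (λ x → ∑-mono-≤ λ y →
             𝟙-≤-+ (adj? G x y) ((x , y) ∈E? edges G) ((y , x) ∈E? edges G) (λ adj → adj)) ⟩
      ∑[ x < n ] ∑[ y < n ] (𝟙∈ (x , y) + 𝟙∈ (y , x))
        ≡⟨ ∑∑-distrib-+ _ _ ⟩
      ∑[ x < n ] ∑[ y < n ] 𝟙∈ (x , y) + ∑[ x < n ] ∑[ y < n ] 𝟙∈ (y , x)
        ≡⟨ cong (∑[ x < n ] ∑[ y < n ] 𝟙∈ (x , y) +_) (∑-comm (λ x y → 𝟙∈ (y , x))) ⟩
      ∑[ x < n ] ∑[ y < n ] 𝟙∈ (x , y) + ∑[ y < n ] ∑[ x < n ] 𝟙∈ (y , x)
        ≤⟨ +-mono-≤ (∑∑-𝟙∈ (edges G)) (∑∑-𝟙∈ (edges G)) ⟩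
      numEdges G + numEdges G
        ≡⟨ cong (numEdges G +_) (+-identityʳ _) ⟨
      2 * numEdges G ∎
      where
      open ≤-Reasoning
      𝟙∈ : Edge n → ℕ
      𝟙∈ e = 𝟙 (e ∈E? edges G)

    copies-≤ : ∀ r (G : Graph n) → copies r G ≤ (2 * numEdges G) ^ r
    copies-≤ r G = begin
      copies r G
        ≤⟨ ∑Maps-mono-≤ r (λ a → ∑Maps-mono-≤ r λ b → 𝟙-≤ (isKrr? r G a b) λ (_ , _ , _ , adj) →
             ∏-positive _ λ i → 𝟙-positive⁺ (adj? G (a i) (b i)) (adj i i)) ⟩
      ∑[ a ∶ r ⟶ n ] ∑[ b ∶ r ⟶ n ] ∏ (λ i → 𝟙adj (a i) (b i))
        ≡⟨ ∑Maps-cong r (λ a → ∑Maps-∏ r (λ i → 𝟙adj (a i))) ⟩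
      ∑[ a ∶ r ⟶ n ] ∏ (λ i → ∑[ y < n ] 𝟙adj (a i) y)
        ≡⟨ ∑Maps-∏ r (λ _ x → ∑[ y < n ] 𝟙adj x y) ⟩
      ∏ {r} (λ _ → ∑[ x < n ] ∑[ y < n ] 𝟙adj x y)
        ≡⟨ ∏-const r (∑[ x < n ] ∑[ y < n ] 𝟙adj x y) ⟩
      (∑[ x < n ] ∑[ y < n ] 𝟙adj x y) ^ r
        ≤⟨ ^-monoˡ-≤ r (∑∑-𝟙adj G) ⟩
      (2 * numEdges G) ^ r ∎
      where
      open ≤-Reasoning
      𝟙adj : Fin n → Fin n → ℕ
      𝟙adj x y = 𝟙 (adj? G x y)

module RandomSubgraph where

  open import Data.Nat
  open import Data.Nat.Properties
  open import Data.Bool using (Bool; true)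
  open import Data.Fin using (Fin; zero; suc; remQuot; combine)
  open import Data.Fin.Properties using (any?; combine-remQuot)
  open import Data.List using (lookup)
  open import Data.List.Relation.Unary.Any using (index)
  open import Data.List.Relation.Unary.Any.Properties using (lookup-index)
  open import Data.List.Membership.Propositional using (_∈_)
  open import Data.List.Membership.Propositional.Properties using (∈-lookup)
  open import Data.Product using (Σ; ∃; ∃₂; _×_; _,_; proj₁; proj₂; uncurry)
  open import Data.Sum using (_⊎_; inj₁; inj₂)
  open import Relation.Binary.PropositionalEquality
    using (_≡_; refl; sym; trans; cong; cong₂; subst; module ≡-Reasoning)
  open import Relation.Nullary using (Dec; yes; no; does; contradiction)
  open import Relation.Nullary.Decidable using (_⊎-dec_; dec-true)
  open import Function using (_∘_)
  open import Function.Definitions using (Injective)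
  open import Algebra.Properties.Semiring.Sum +-*-semiring using (sum-syntax; sum-cong-≗; *-distribˡ-sum)
  open import Data.Nat.Tactic.RingSolver using (solve-∀)
  open FiniteSums
  open Colourings
  open ListSelection
  open Indicators
  open KrrCopies

  module _ {n : ℕ} where

    Joins : Edge n → Fin n → Fin n → Set
    Joins e u v = e ≡ (u , v) ⊎ e ≡ (v , u)

    joins? : ∀ e u v → Dec (Joins e u v)
    joins? e u v = (e ≟E (u , v)) ⊎-dec (e ≟E (v , u))

    Adj⇒Joins : ∀ {G : Graph n} {u v} → Adj G u v → ∃ λ e → e ∈ edges G × Joins e u v
    Adj⇒Joins (inj₁ uv∈) = _ , uv∈ , inj₁ refl
    Adj⇒Joins (inj₂ vu∈) = _ , vu∈ , inj₂ refl

    Joins-unique : ∀ (G : Graph n) {e f u v} → e ∈ edges G → f ∈ edges G → Joins e u v → Joins f u v → e ≡ f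
    Joins-unique G e∈ f∈ (inj₁ refl) (inj₁ refl) = refl
    Joins-unique G e∈ f∈ (inj₁ refl) (inj₂ refl) = contradiction f∈ (∈-edges-asym G e∈)
    Joins-unique G e∈ f∈ (inj₂ refl) (inj₁ refl) = contradiction e∈ (∈-edges-asym G f∈)
    Joins-unique G e∈ f∈ (inj₂ refl) (inj₂ refl) = refl

    Joins-IsKrr-injective : ∀ {r G a b} → IsKrr r G a b → ∀ {e i j k l} →
      Joins e (a i) (b j) → Joins e (a k) (b l) → (i , j) ≡ (k , l)
    Joins-IsKrr-injective (a-inj , b-inj , _ , _) (inj₁ refl) (inj₁ eq) =
      cong₂ _,_ (a-inj (cong proj₁ eq)) (b-inj (cong proj₂ eq))
    Joins-IsKrr-injective (_ , _ , a≢b , _) (inj₁ refl) (inj₂ eq) = contradiction (cong proj₁ eq) (a≢b _ _)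
    Joins-IsKrr-injective (_ , _ , a≢b , _) (inj₂ refl) (inj₁ eq) = contradiction (cong proj₁ eq) (a≢b _ _ ∘ sym)
    Joins-IsKrr-injective (a-inj , b-inj , _ , _) (inj₂ refl) (inj₂ eq) =
      cong₂ _,_ (a-inj (cong proj₂ eq)) (b-inj (cong proj₁ eq))

  module _ {n : ℕ} (G : Graph n) (D : ℕ) where

    private
      E = edges G
      m = numEdges G
      K = suc D

    -- The colourings c of the edge positions form the probability space; the
    -- sample keeps the edges of colour zero.
    sample : (Fin m → Fin K) → Graph n
    sample c = record
      { edges    = keep E c
      ; ordered  = keep⁺ c (ordered G)
      ; distinct = keep-Unique c (distinct G)
      }

    sample-⊆ : ∀ c → sample c ⊆G G
    sample-⊆ c e = keep-⊆ E c

    ∑-numEdges-sample : K * ∑[ c ∶ m ⟶ K ] numEdges (sample c) ≡ m * K ^ m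
    ∑-numEdges-sample = begin
      K * ∑[ c ∶ m ⟶ K ] numEdges (sample c)
        ≡⟨ cong (K *_) (∑Maps-cong m (length-keep E)) ⟩
      K * ∑[ c ∶ m ⟶ K ] ∑[ p < m ] isZero (c p)
        ≡⟨ cong (K *_) (∑Maps-∑-comm m (λ c p → isZero (c p))) ⟩
      K * ∑[ p < m ] ∑[ c ∶ m ⟶ K ] isZero (c p)
        ≡⟨ *-distribˡ-sum K (λ p → ∑[ c ∶ m ⟶ K ] isZero (c p)) ⟩
      ∑[ p < m ] (K * ∑[ c ∶ m ⟶ K ] isZero (c p))
        ≡⟨ sum-cong-≗ {m} (λ p → trans (*-comm K _) (∑Maps-isZero m p)) ⟩
      ∑[ p < m ] (K ^ m)
        ≡⟨ ∑-const m (K ^ m) ⟩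
      m * K ^ m ∎
      where open ≡-Reasoning

    module _ (r : ℕ) {a b : Fin r → Fin n} (krr : IsKrr r G a b) where

      private
        adj = proj₂ (proj₂ (proj₂ krr))

      InCopy : Edge n → Set
      InCopy e = ∃₂ λ i j → Joins e (a i) (b j)

      inCopy? : ∀ e → Dec (InCopy e)
      inCopy? e = any? λ i → any? λ j → joins? e (a i) (b j)

      copyPositions : Fin m → Bool
      copyPositions p = does (inCopy? (lookup E p))

      position : Fin r → Fin r → Fin m
      position i j = index (proj₁ (proj₂ (Adj⇒Joins {G = G} (adj i j))))

      Joins-position : ∀ i j → Joins (lookup E (position i j)) (a i) (b j)
      Joins-position i j with Adj⇒Joins {G = G} (adj i j)
      ... | _ , e∈ , J = subst (λ e → Joins e (a i) (b j)) (lookup-index e∈) J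

      position-injective : ∀ {i j k l} → position i j ≡ position k l → (i , j) ≡ (k , l)
      position-injective {i} {j} {k} {l} eq = Joins-IsKrr-injective {G = G} krr (Joins-position i j)
        (subst (λ p → Joins (lookup E p) (a k) (b l)) (sym eq) (Joins-position k l))

      count-copyPositions : r * r ≤ count copyPositions
      count-copyPositions = count-≥ copyPositions g g-injective
        (λ x → dec-true (inCopy? _) (_ , _ , Joins-position _ _))
        where
        g : Fin (r * r) → Fin m
        g = uncurry position ∘ remQuot {r} r
        g-injective : Injective _≡_ _≡_ g
        g-injective {x} {y} gx≡gy = begin
          x                               ≡⟨ combine-remQuot {r} r x ⟨
          uncurry combine (remQuot {r} r x)   ≡⟨ cong (uncurry combine) (position-injective gx≡gy) ⟩
          uncurry combine (remQuot {r} r y)   ≡⟨ combine-remQuot {r} r y ⟩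
          y                               ∎
          where open ≡-Reasoning

      sample-IsKrr⇒zeroOn : ∀ c → IsKrr r (sample c) a b → ∀ p → copyPositions p ≡ true → c p ≡ zero
      sample-IsKrr⇒zeroOn c (_ , _ , _ , adjS) p _ with inCopy? (lookup E p)
      ... | yes (i , j , J) with Adj⇒Joins {G = sample c} (adjS i j)
      ...   | f , f∈ , J′ with ∈-keep⁻ E c f∈
      ...     | p′ , p′↦f , cp′≡0 = subst (λ q → c q ≡ zero) (sym p≡p′) cp′≡0
        where
        p≡p′ : p ≡ p′
        p≡p′ = lookup-injective (distinct G)
          (Joins-unique G (∈-lookup p) (∈-lookup p′) J (subst (λ e → Joins e (a i) (b j)) (sym p′↦f) J′))

    ∑-isKrr-sample : ∀ r a b →
      (∑[ c ∶ m ⟶ K ] 𝟙 (isKrr? r (sample c) a b)) * K ^ (r * r) ≤ 𝟙 (isKrr? r G a b) * K ^ m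
    ∑-isKrr-sample r a b with isKrr? r G a b
    ... | no ¬krr = *-monoˡ-≤ (K ^ (r * r)) (begin
      ∑[ c ∶ m ⟶ K ] 𝟙 (isKrr? r (sample c) a b)
        ≤⟨ ∑Maps-mono-≤ m (λ c → 𝟙-≤ (isKrr? r (sample c) a b) λ krr →
             contradiction (IsKrr-mono r {sample c} {G} (sample-⊆ c) krr) ¬krr) ⟩
      ∑[ c ∶ m ⟶ K ] 0
        ≡⟨ trans (∑Maps-const m K 0) (*-zeroʳ (K ^ m)) ⟩
      0 ∎)
      where open ≤-Reasoning
    ... | yes krr = begin
      (∑[ c ∶ m ⟶ K ] 𝟙 (isKrr? r (sample c) a b)) * K ^ (r * r)
        ≤⟨ *-mono-≤ (∑Maps-mono-≤ m λ c → 𝟙-≤ (isKrr? r (sample c) a b)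
                       (zeroOn-positive T c ∘ sample-IsKrr⇒zeroOn r krr c))
                    (^-monoʳ-≤ K (count-copyPositions r krr)) ⟩
      (∑[ c ∶ m ⟶ K ] zeroOn T c) * K ^ count T
        ≡⟨ ∑Maps-zeroOn m T ⟩
      K ^ m
        ≡⟨ +-identityʳ (K ^ m) ⟨
      1 * K ^ m ∎
      where
      open ≤-Reasoning
      T = copyPositions r krr

    ∑-copies-sample : ∀ r → (∑[ c ∶ m ⟶ K ] copies r (sample c)) * K ^ (r * r) ≤ copies r G * K ^ m
    ∑-copies-sample r = begin
      (∑[ c ∶ m ⟶ K ] ∑[ a ∶ r ⟶ n ] ∑[ b ∶ r ⟶ n ] 𝟙S c a b) * Q
        ≡⟨ cong (_* Q) (trans (∑Maps-comm m r λ c a → ∑Maps r n (𝟙S c a))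
                              (∑Maps-cong r λ a → ∑Maps-comm m r λ c → 𝟙S c a)) ⟩
      (∑[ a ∶ r ⟶ n ] ∑[ b ∶ r ⟶ n ] ∑[ c ∶ m ⟶ K ] 𝟙S c a b) * Q
        ≡⟨ trans (*-distribʳ-∑Maps r Q _) (∑Maps-cong r λ a → *-distribʳ-∑Maps r Q _) ⟩
      ∑[ a ∶ r ⟶ n ] ∑[ b ∶ r ⟶ n ] ((∑[ c ∶ m ⟶ K ] 𝟙S c a b) * Q)
        ≤⟨ ∑Maps-mono-≤ r (λ a → ∑Maps-mono-≤ r λ b → ∑-isKrr-sample r a b) ⟩
      ∑[ a ∶ r ⟶ n ] ∑[ b ∶ r ⟶ n ] (𝟙 (isKrr? r G a b) * K ^ m)
        ≡⟨ trans (*-distribʳ-∑Maps r (K ^ m) _) (∑Maps-cong r λ a → *-distribʳ-∑Maps r (K ^ m) _) ⟨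
      copies r G * K ^ m ∎
      where
      open ≤-Reasoning
      Q = K ^ (r * r)
      𝟙S : (Fin m → Fin K) → (Fin r → Fin n) → (Fin r → Fin n) → ℕ
      𝟙S c a b = 𝟙 (isKrr? r (sample c) a b)

    -- Divided by Q·K: e(S) − copies(S) ≥ m/K − copies(G)/K^(r²), true on average.
    good-colouring : ∀ r → let Q = K ^ (r * r) in ∃ λ c →
      Q * m + K * (Q * copies r (sample c)) ≤ Q * (K * numEdges (sample c)) + K * copies r G
    good-colouring r = ∑Maps-≤⇒∃-≤ m R L ∑L≤∑R
      where
      Q = K ^ (r * r)
      B = copies r G
      L R : (Fin m → Fin K) → ℕ
      L c = Q * m + K * (Q * copies r (sample c))
      R c = Q * (K * numEdges (sample c)) + K * B
      ∑L≤∑R : ∑Maps m K L ≤ ∑Maps m K R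
      ∑L≤∑R = begin
        ∑Maps m K L
          ≡⟨ ∑Maps-distrib-+ m _ _ ⟩
        ∑[ c ∶ m ⟶ K ] (Q * m) + ∑[ c ∶ m ⟶ K ] (K * (Q * copies r (sample c)))
          ≡⟨ cong₂ _+_ (∑Maps-const m K (Q * m))
                       (sym (trans (cong (K *_) (*-distribˡ-∑Maps m Q _)) (*-distribˡ-∑Maps m K _))) ⟩
        K ^ m * (Q * m) + K * (Q * ∑[ c ∶ m ⟶ K ] copies r (sample c))
          ≤⟨ +-monoʳ-≤ (K ^ m * (Q * m)) (*-monoʳ-≤ K (≤-trans (≤-reflexive (*-comm Q _))
                                                                (∑-copies-sample r))) ⟩
        K ^ m * (Q * m) + K * (B * K ^ m)
          ≡⟨ rearrange (K ^ m) Q m K B ⟩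
        Q * (m * K ^ m) + K ^ m * (K * B)
          ≡⟨ cong (λ x → Q * x + K ^ m * (K * B)) ∑-numEdges-sample ⟨
        Q * (K * ∑[ c ∶ m ⟶ K ] numEdges (sample c)) + K ^ m * (K * B)
          ≡⟨ cong₂ _+_ (trans (cong (Q *_) (*-distribˡ-∑Maps m K _)) (*-distribˡ-∑Maps m Q _))
                       (sym (∑Maps-const m K (K * B))) ⟩
        ∑[ c ∶ m ⟶ K ] (Q * (K * numEdges (sample c))) + ∑[ c ∶ m ⟶ K ] (K * B)
          ≡⟨ ∑Maps-distrib-+ m _ _ ⟨
        ∑Maps m K R ∎
        where
        open ≤-Reasoning
        rearrange : ∀ P Q m K B → P * (Q * m) + K * (B * P) ≡ Q * (m * P) + P * (K * B)
        rearrange = solve-∀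

  large-KrrFree-subgraph : ∀ {n} r D (G : Graph n) → let s = suc r ; K = suc D ; Q = K ^ (s * s) in
    Σ (Graph n) λ H → H ⊆G G × KrrFree s H × Q * numEdges G ≤ Q * K * numEdges H + K * copies s G
  large-KrrFree-subgraph r D G =
    let c , avg = good-colouring G D (suc r)
        H , H⊆S , free , |S|≤ = KrrFree-subgraph r (sample G D c)
    in H , (λ e → sample-⊆ G D c e ∘ H⊆S e) , free ,
       delete-copies {suc D ^ (suc r * suc r)} {suc D} avg |S|≤
    where
    delete-copies : ∀ {Q K m e c h B} → Q * m + K * (Q * c) ≤ Q * (K * e) + K * B → e ≤ h + c →
      Q * m ≤ Q * K * h + K * B
    delete-copies {Q} {K} {m} {e} {c} {h} {B} avg e≤h+c = +-cancelʳ-≤ (K * (Q * c)) _ _ (begin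
      Q * m + K * (Q * c)                    ≤⟨ avg ⟩
      Q * (K * e) + K * B                    ≤⟨ +-monoˡ-≤ (K * B) (*-monoʳ-≤ Q (*-monoʳ-≤ K e≤h+c)) ⟩
      Q * (K * (h + c)) + K * B              ≡⟨ rearrange Q K h c B ⟩
      Q * K * h + K * B + K * (Q * c)        ∎)
      where
      open ≤-Reasoning
      rearrange : ∀ Q K h c B → Q * (K * (h + c)) + K * B ≡ Q * K * h + K * B + K * (Q * c)
      rearrange = solve-∀

module Arithmetic where

  open import Data.Nat
  open import Data.Nat.Properties
  open import Data.Nat.Tactic.RingSolver using (solve-∀)
  open import Data.Product using (∃; _×_; _,_)
  open import Relation.Binary.PropositionalEquality using (_≡_; refl; sym; trans; cong; subst)
  open import Relation.Nullary using (yes; no)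
  open import Algebra.Properties.CommutativeSemigroup *-commutativeSemigroup using (x∙yz≈y∙xz)

  ^-distribʳ-* : ∀ m n k → (m * n) ^ k ≡ m ^ k * n ^ k
  ^-distribʳ-* m n zero    = refl
  ^-distribʳ-* m n (suc k) = trans (cong (m * n *_) (^-distribʳ-* m n k)) (lemma m n (m ^ k) (n ^ k))
    where
    lemma : ∀ m n x y → m * n * (x * y) ≡ m * x * (n * y)
    lemma = solve-∀

  m≤m^[1+n] : ∀ m .{{_ : NonZero m}} n → m ≤ m ^ suc n
  m≤m^[1+n] m n = begin
    m              ≡⟨ *-identityʳ m ⟨
    m * 1          ≤⟨ *-monoʳ-≤ m (m^n>0 m n) ⟩
    m ^ suc n      ∎
    where open ≤-Reasoning

  root-bracket : ∀ t M → 2 ^ suc t ≤ M → ∃ λ k → 2 ≤ k × k ^ suc t ≤ M × M ≤ suc k ^ suc t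
  root-bracket t M 2^t≤M = search M (≤-trans (m≤n+m M 3) (m≤m^[1+n] (3 + M) t))
    where
    search : ∀ d → M ≤ (3 + d) ^ suc t → ∃ λ k → 2 ≤ k × k ^ suc t ≤ M × M ≤ suc k ^ suc t
    search zero    M≤3^t = 2 , ≤-refl , 2^t≤M , M≤3^t
    search (suc d) M≤    with M ≤? (3 + d) ^ suc t
    ... | yes M≤′ = search d M≤′
    ... | no  M≰  = 3 + d , s≤s (s≤s z≤n) , <⇒≤ (≰⇒> M≰) , M≤

  -- For r = 2 the estimate is tight when K³ = 8m, leaving no slack for rounding K up;
  -- this inequality absorbs the rounding error w = K³ − 8m.
  [8m+w]^4≤64m[4m+w]^3 : ∀ m w → w ≤ 32 * m → (8 * m + w) ^ 4 ≤ 64 * m * (4 * m + w) ^ 3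
  [8m+w]^4≤64m[4m+w]^3 m w w≤32m = +-cancelʳ-≤ (32 * m * w ^ 3) _ _ (begin
    (8 * m + w) ^ 4 + 32 * m * w ^ 3                      ≤⟨ m≤m+n _ _ ⟩
    (8 * m + w) ^ 4 + 32 * m * w ^ 3 + (1024 * m ^ 3 * w + 384 * m ^ 2 * w ^ 2)
                                                          ≡⟨ identity m w ⟩
    64 * m * (4 * m + w) ^ 3 + w * w ^ 3                  ≤⟨ +-monoʳ-≤ _ (*-monoˡ-≤ (w ^ 3) w≤32m) ⟩
    64 * m * (4 * m + w) ^ 3 + 32 * m * w ^ 3             ∎)
    where
    open ≤-Reasoning
    -- The ring solver does not handle _^_, so powers are unfolded here.
    identity : ∀ m w → let x = 8 * m + w ; y = 4 * m + w in
      x * (x * (x * (x * 1))) + 32 * m * (w * (w * (w * 1)))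
        + (1024 * (m * (m * (m * 1))) * w + 384 * (m * (m * 1)) * (w * (w * 1)))
      ≡ 64 * m * (y * (y * (y * 1))) + w * (w * (w * (w * 1)))
    identity = solve-∀

  m^2≤[4h]^3 : ∀ {m h B k} → 2 ≤ k → let K = suc k ; A = K ^ 3 in
    k ^ 3 ≤ 8 * m → 8 * m ≤ A → B ≤ (2 * m) ^ 2 → A * m ≤ A * K * h + B → m ^ 2 ≤ (4 * h) ^ 3
  m^2≤[4h]^3 {m} {h} {B} {k} 2≤k k³≤8m 8m≤A B≤[2m]² main =
    *-cancelʳ-≤ (m ^ 2) ((4 * h) ^ 3) (A ^ 4) (begin
      m ^ 2 * A ^ 4                       ≡⟨ cong (λ x → m ^ 2 * x ^ 4) A≡8m+w ⟩
      m ^ 2 * (8 * m + w) ^ 4             ≤⟨ *-monoʳ-≤ (m ^ 2) ([8m+w]^4≤64m[4m+w]^3 m w w≤32m) ⟩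
      m ^ 2 * (64 * m * (4 * m + w) ^ 3)  ≡⟨ regroup m (4 * m + w) ⟩
      64 * (m * (4 * m + w)) ^ 3          ≤⟨ *-monoʳ-≤ 64 (^-monoˡ-≤ 3 m[4m+w]≤AKh) ⟩
      64 * (A * K * h) ^ 3                ≡⟨ 64[AKh]^3≡[4h]^3A^4 k h ⟩
      (4 * h) ^ 3 * A ^ 4                 ∎)
    where
    open ≤-Reasoning
    K = suc k
    A = K ^ 3
    w = A ∸ 8 * m

    expand : ∀ m w → m * (4 * m + w) + 2 * m * (2 * m * 1) ≡ (8 * m + w) * m
    expand = solve-∀

    regroup : ∀ m y → m * (m * 1) * (64 * m * (y * (y * (y * 1)))) ≡ 64 * (m * y * (m * y * (m * y * 1)))
    regroup = solve-∀

    64[AKh]^3≡[4h]^3A^4 : ∀ k h → let K = suc k ; A = K * (K * (K * 1)) ; x = A * K * h ; y = 4 * h in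
      64 * (x * (x * (x * 1))) ≡ y * (y * (y * 1)) * (A * (A * (A * (A * 1))))
    64[AKh]^3≡[4h]^3A^4 = solve-∀

    A≡8m+w : A ≡ 8 * m + w
    A≡8m+w = sym (m+[n∸m]≡n 8m≤A)

    A≤27m : A ≤ 27 * m
    A≤27m = *-cancelˡ-≤ 8 (begin
      8 * A         ≡⟨ ^-distribʳ-* 2 K 3 ⟨
      (2 * K) ^ 3   ≤⟨ ^-monoˡ-≤ 3 (≤-trans (≤-reflexive (*-suc 2 k)) (+-monoˡ-≤ (2 * k) 2≤k)) ⟩
      (3 * k) ^ 3   ≡⟨ ^-distribʳ-* 3 k 3 ⟩
      27 * k ^ 3    ≤⟨ *-monoʳ-≤ 27 k³≤8m ⟩
      27 * (8 * m)  ≡⟨ x∙yz≈y∙xz 27 8 m ⟩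
      8 * (27 * m)  ∎)

    w≤32m : w ≤ 32 * m
    w≤32m = ≤-trans (+-cancelˡ-≤ (8 * m) w (19 * m) (begin
      8 * m + w       ≡⟨ A≡8m+w ⟨
      A               ≤⟨ A≤27m ⟩
      27 * m          ≡⟨ *-distribʳ-+ m 8 19 ⟩
      8 * m + 19 * m  ∎)) (*-monoˡ-≤ m (m≤m+n 19 13))

    m[4m+w]≤AKh : m * (4 * m + w) ≤ A * K * h
    m[4m+w]≤AKh = +-cancelʳ-≤ ((2 * m) ^ 2) _ _ (begin
      m * (4 * m + w) + (2 * m) ^ 2  ≡⟨ expand m w ⟩
      (8 * m + w) * m                ≡⟨ cong (_* m) A≡8m+w ⟨
      A * m                          ≤⟨ main ⟩
      A * K * h + B                  ≤⟨ +-monoʳ-≤ (A * K * h) B≤[2m]² ⟩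
      A * K * h + (2 * m) ^ 2        ∎)

  m^r≤[4h]^[1+r]-for-r≥3 : ∀ r′ {m h B k} → 2 ≤ r′ → 0 < m → 2 ≤ k →
    let r = suc r′ ; t = suc r ; K = suc k ; J = (K ^ t) ^ r′ in
    k ^ t ≤ 2 ^ t * m → 2 ^ t * m ≤ K ^ t → B ≤ (2 * m) ^ r → J * m ≤ J * K * h + B → m ^ r ≤ (4 * h) ^ t
  m^r≤[4h]^[1+r]-for-r≥3 r′ {m} {h} {B} {k} 2≤r′ m>0 2≤k k^t≤2^tm 2^tm≤K^t B≤[2m]^r main =
    *-cancelˡ-≤ (124 ^ t * m) {{>-nonZero (*-mono-≤ (m^n>0 124 t) m>0)}} (begin
      124 ^ t * m * m ^ r          ≡⟨ *-assoc (124 ^ t) m (m ^ r) ⟩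
      124 ^ t * m ^ t              ≡⟨ ^-distribʳ-* 124 m t ⟨
      (124 * m) ^ t                ≤⟨ ^-monoˡ-≤ t 124m≤32K*4h ⟩
      (32 * K * (4 * h)) ^ t       ≡⟨ ^-distribʳ-* (32 * K) (4 * h) t ⟩
      (32 * K) ^ t * (4 * h) ^ t   ≤⟨ *-monoˡ-≤ ((4 * h) ^ t) [32K]^t≤124^tm ⟩
      124 ^ t * m * (4 * h) ^ t    ∎)
    where
    open ≤-Reasoning
    r = suc r′
    t = suc r
    K = suc k
    J = (K ^ t) ^ r′

    J≥[2^t]^r′m^r′ : 2 ^ (t * r′) * m ^ r′ ≤ J
    J≥[2^t]^r′m^r′ = begin
      2 ^ (t * r′) * m ^ r′   ≡⟨ cong (_* m ^ r′) (^-*-assoc 2 t r′) ⟨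
      (2 ^ t) ^ r′ * m ^ r′   ≡⟨ ^-distribʳ-* (2 ^ t) m r′ ⟨
      (2 ^ t * m) ^ r′        ≤⟨ ^-monoˡ-≤ r′ 2^tm≤K^t ⟩
      J                       ∎

    5+r≤t*r′ : 5 + r ≤ t * r′
    5+r≤t*r′ = begin
      2 + 2 * 2 + r′          ≤⟨ +-monoˡ-≤ r′ (+-mono-≤ 2≤r′ (*-mono-≤ 2≤r′ 2≤r′)) ⟩
      r′ + r′ * r′ + r′       ≡⟨ lemma r′ ⟩
      t * r′                  ∎
      where
      lemma : ∀ r′ → r′ + r′ * r′ + r′ ≡ (2 + r′) * r′
      lemma = solve-∀

    32B≤Jm : 32 * B ≤ J * m
    32B≤Jm = begin
      32 * B                        ≤⟨ *-monoʳ-≤ 32 B≤[2m]^r ⟩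
      32 * (2 * m) ^ r              ≡⟨ cong (32 *_) (^-distribʳ-* 2 m r) ⟩
      32 * (2 ^ r * m ^ r)          ≡⟨ *-assoc 32 (2 ^ r) (m ^ r) ⟨
      32 * 2 ^ r * m ^ r            ≡⟨ cong (_* m ^ r) (^-distribˡ-+-* 2 5 r) ⟨
      2 ^ (5 + r) * m ^ r           ≤⟨ *-monoˡ-≤ (m ^ r) (^-monoʳ-≤ 2 5+r≤t*r′) ⟩
      2 ^ (t * r′) * (m * m ^ r′)   ≡⟨ x∙yz≈y∙xz (2 ^ (t * r′)) m (m ^ r′) ⟩
      m * (2 ^ (t * r′) * m ^ r′)   ≤⟨ *-monoʳ-≤ m J≥[2^t]^r′m^r′ ⟩
      m * J                         ≡⟨ *-comm m J ⟩
      J * m                         ∎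

    31m≤32Kh : 31 * m ≤ 32 * K * h
    31m≤32Kh = *-cancelˡ-≤ J {{m^n≢0 (K ^ t) r′ {{m^n≢0 K t}}}} (+-cancelʳ-≤ (J * m) _ _ (begin
      J * (31 * m) + J * m           ≡⟨ lemma₁ J m ⟩
      32 * (J * m)                   ≤⟨ *-monoʳ-≤ 32 main ⟩
      32 * (J * K * h + B)           ≡⟨ *-distribˡ-+ 32 (J * K * h) B ⟩
      32 * (J * K * h) + 32 * B      ≤⟨ +-monoʳ-≤ (32 * (J * K * h)) 32B≤Jm ⟩
      32 * (J * K * h) + J * m       ≡⟨ cong (_+ J * m) (lemma₂ J K h) ⟩
      J * (32 * K * h) + J * m       ∎))
      where
      lemma₁ : ∀ J m → J * (31 * m) + J * m ≡ 32 * (J * m)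
      lemma₁ = solve-∀
      lemma₂ : ∀ J K h → 32 * (J * K * h) ≡ J * (32 * K * h)
      lemma₂ = solve-∀

    124m≤32K*4h : 124 * m ≤ 32 * K * (4 * h)
    124m≤32K*4h = begin
      124 * m             ≡⟨ *-assoc 4 31 m ⟩
      4 * (31 * m)        ≤⟨ *-monoʳ-≤ 4 31m≤32Kh ⟩
      4 * (32 * K * h)    ≡⟨ lemma K h ⟩
      32 * K * (4 * h)    ∎
      where
      lemma : ∀ K h → 4 * (32 * K * h) ≡ 32 * K * (4 * h)
      lemma = solve-∀

    [32K]^t≤124^tm : (32 * K) ^ t ≤ 124 ^ t * m
    [32K]^t≤124^tm = begin
      (32 * K) ^ t           ≤⟨ ^-monoˡ-≤ t 32K≤62k ⟩
      (62 * k) ^ t           ≡⟨ ^-distribʳ-* 62 k t ⟩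
      62 ^ t * k ^ t         ≤⟨ *-monoʳ-≤ (62 ^ t) k^t≤2^tm ⟩
      62 ^ t * (2 ^ t * m)   ≡⟨ *-assoc (62 ^ t) (2 ^ t) m ⟨
      62 ^ t * 2 ^ t * m     ≡⟨ cong (_* m) (^-distribʳ-* 62 2 t) ⟨
      124 ^ t * m            ∎
      where
      32K≤62k : 32 * K ≤ 62 * k
      32K≤62k = begin
        32 * suc k       ≡⟨ *-suc 32 k ⟩
        32 + 32 * k      ≤⟨ +-monoˡ-≤ (32 * k) (*-monoʳ-≤ 16 2≤k) ⟩
        16 * k + 32 * k  ≡⟨ *-distribʳ-+ k 16 32 ⟨
        48 * k           ≤⟨ *-monoˡ-≤ k (m≤m+n 48 14) ⟩
        62 * k           ∎

  cancel-K : ∀ r′ {m h B K} → 0 < K → let r = suc r′ ; J = (K ^ suc r) ^ r′ in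
    K ^ (r * r) * m ≤ K ^ (r * r) * K * h + K * B → J * m ≤ J * K * h + B
  cancel-K r′ {m} {h} {B} {K} K>0 main = *-cancelˡ-≤ K {{>-nonZero K>0}} (begin
    K * (J * m)               ≡⟨ *-assoc K J m ⟨
    K * J * m                 ≡⟨ cong (_* m) K^[r*r]≡K*J ⟨
    K ^ (r * r) * m           ≤⟨ main ⟩
    K ^ (r * r) * K * h + K * B ≡⟨ cong (λ x → x * K * h + K * B) K^[r*r]≡K*J ⟩
    K * J * K * h + K * B     ≡⟨ lemma K J h B ⟩
    K * (J * K * h + B)       ∎)
    where
    open ≤-Reasoning
    r = suc r′
    J = (K ^ suc r) ^ r′
    K^[r*r]≡K*J : K ^ (r * r) ≡ K * J
    K^[r*r]≡K*J = trans (cong (K ^_) (r*r r′)) (cong (K *_) (sym (^-*-assoc K (suc r) r′)))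
      where
      r*r : ∀ r′ → suc r′ * suc r′ ≡ suc ((2 + r′) * r′)
      r*r = solve-∀
    lemma : ∀ K J h B → K * J * K * h + K * B ≡ K * (J * K * h + B)
    lemma = solve-∀

  m^r≤[4h]^[1+r] : ∀ r {m h B k} → 2 ≤ r → 0 < m → 2 ≤ k → let t = suc r ; K = suc k in
    k ^ t ≤ 2 ^ t * m → 2 ^ t * m ≤ K ^ t → B ≤ (2 * m) ^ r →
    K ^ (r * r) * m ≤ K ^ (r * r) * K * h + K * B → m ^ r ≤ (4 * h) ^ t
  m^r≤[4h]^[1+r] 1 (s≤s ())
  m^r≤[4h]^[1+r] 2 {m} {h} {B} {k} _ _ 2≤k k^t≤ ≤K^t B≤ main =
    m^2≤[4h]^3 2≤k k^t≤ ≤K^t B≤ (subst (λ A → A * m ≤ A * suc k * h + B) (*-identityʳ (suc k ^ 3))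
      (cancel-K 1 {m} {h} {B} {suc k} (s≤s z≤n) main))
  m^r≤[4h]^[1+r] (suc (suc (suc r))) {m} {h} {B} {k} _ m>0 2≤k k^t≤ ≤K^t B≤ main =
    m^r≤[4h]^[1+r]-for-r≥3 (2 + r) (s≤s (s≤s z≤n)) m>0 2≤k k^t≤ ≤K^t B≤
      (cancel-K (2 + r) {m} {h} {B} {suc k} (s≤s z≤n) main)

open KrrCopies using (copies-≤)
open RandomSubgraph using (large-KrrFree-subgraph)
open Arithmetic using (root-bracket; m^r≤[4h]^[1+r])

theorem1 : (r : ℕ) → 2 ≤ r → (n : ℕ) (G : Graph n) → 1 ≤ numEdges G →
  Σ (Graph n) (λ H → (H ⊆G G) × KrrFree r H ×
    (numEdges G ^ r ≤ (4 * numEdges H) ^ suc r))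
theorem1 r@(suc r′) 2≤r n G m>0 =
  let M = 2 ^ suc r * numEdges G
      k , 2≤k , k^t≤M , M≤[1+k]^t = root-bracket r M (m≤m*n (2 ^ suc r) (numEdges G) {{>-nonZero m>0}})
      H , H⊆G , free , main = large-KrrFree-subgraph r′ k G
  in H , H⊆G , free , m^r≤[4h]^[1+r] r 2≤r m>0 2≤k k^t≤M M≤[1+k]^t (copies-≤ r G) main
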